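{- Let $F_v(t,q)$ be the generating series, by half-perimeter ($t$) and area ($q$), of convex polyominoes invariant under reflection in a vertical axis, and let $T(x,y,q)$ be the generating series of stack polyominoes by width ($x$), height ($y$) and area ($q$). Then $$F_v(t,q)=T(t^2,t,q^2)+\frac1t\,T\big(t^2,\tfrac tq,q^2\big).$$
   Context: A polyomino is a finite edge-connected union of unit cells of the square lattice, up to translation; convex means its intersection with every horizontal and vertical line is connected. Half-perimeter is width plus height. A stack polyomino is a pile of nonempty horizontal rows at consecutive heights, all starting at the same leftmost column, whose lengths read from bottom to top are weakly increasing then weakly decreasing. Invariance under a reflection means the reflection maps the polyomino to a translate of itself. -}

module Defs where

open import Data.Nat using (ℕ; zero; suc; _+_; _*_; _∸_; _≤_; _≥_; _⊔_)
open import Data.Bool using (Bool; true; false; if_then_else_)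
open import Data.Fin using (Fin; toℕ)
open import Data.Vec as Vec using (Vec; lookup)
open import Data.List as List using (List; length)
import Data.Nat.ListAction as ListAction
open import Data.List.Relation.Unary.Unique.Propositional using (Unique)
open import Data.List.Relation.Unary.Linked using (Linked)
open import Data.List.Relation.Unary.All using (All)
open import Data.List.Membership.Propositional using (_∈_)
open import Data.Product using (Σ; _×_; _,_; proj₁; proj₂; ∃; ∃-syntax)
open import Data.Sum using (_⊎_)
open import Function.Bundles using (_⇔_)
open import Relation.Binary.PropositionalEquality using (_≡_)

HasCount : {A : Set} → (A → Set) → ℕ → Set
HasCount {A} P k =
  Σ (List A) λ xs → Unique xs × length xs ≡ k × (∀ x → (x ∈ xs) ⇔ P x)

-- A polyomino up to translation is
-- represented by its canonical placement in its (tight) bounding box: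
-- a grid of h rows (bottom to top), each a row of w booleans
-- (left to right); true = the unit cell is present.

Grid : Set
Grid = Σ ℕ λ w → Σ ℕ λ h → Vec (Vec Bool w) h

width : Grid → ℕ
width (w , h , g) = w

height : Grid → ℕ
height (w , h , g) = h

b2n : Bool → ℕ
b2n true  = 1
b2n false = 0

area : Grid → ℕ
area (w , h , g) = Vec.sum (Vec.map (λ r → Vec.sum (Vec.map b2n r)) g)

module _ {w h : ℕ} (g : Vec (Vec Bool w) h) where

  Cell : Set
  Cell = Fin h × Fin w

  Filled : Cell → Set
  Filled (i , j) = lookup (lookup g i) j ≡ true

  Adj : Cell → Cell → Set
  Adj (i , j) (i' , j') =
      (toℕ i ≡ toℕ i' × (suc (toℕ j) ≡ toℕ j' ⊎ suc (toℕ j') ≡ toℕ j))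
    ⊎ (toℕ j ≡ toℕ j' × (suc (toℕ i) ≡ toℕ i' ⊎ suc (toℕ i') ≡ toℕ i))

  data Reach : Cell → Cell → Set where
    here : ∀ {c} → Filled c → Reach c c
    step : ∀ {c d e} → Reach c d → Adj d e → Filled e → Reach c e

  EdgeConnected : Set
  EdgeConnected = ∀ c d → Filled c → Filled d → Reach c d

  RowConvex : Set
  RowConvex = ∀ (i : Fin h) (j k l : Fin w) →
    Filled (i , j) → Filled (i , l) → toℕ j ≤ toℕ k → toℕ k ≤ toℕ l →
    Filled (i , k)

  ColConvex : Set
  ColConvex = ∀ (i k l : Fin h) (j : Fin w) →
    Filled (i , j) → Filled (l , j) → toℕ i ≤ toℕ k → toℕ k ≤ toℕ l →
    Filled (k , j)

  -- the box is the bounding box: each of its four sides meets a cell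
  -- (this also forces the cell set to be nonempty)
  TightBox : Set
  TightBox =
      (∃[ c ] Filled c × toℕ (proj₁ c) ≡ 0)
    × (∃[ c ] Filled c × suc (toℕ (proj₁ c)) ≡ h)
    × (∃[ c ] Filled c × toℕ (proj₂ c) ≡ 0)
    × (∃[ c ] Filled c × suc (toℕ (proj₂ c)) ≡ w)

IsPolyomino : Grid → Set
IsPolyomino (w , h , g) = TightBox g × EdgeConnected g

IsConvexPolyomino : Grid → Set
IsConvexPolyomino G@(w , h , g) = IsPolyomino G × RowConvex g × ColConvex g

-- invariance under reflection in a vertical axis: the mirrored polyomino,
-- put back in its bounding box, is the same.
VerticallySymmetric : Grid → Set
VerticallySymmetric (w , h , g) = Vec.map Vec.reverse g ≡ g

halfPerimeter : Grid → ℕ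
halfPerimeter G = width G + height G

-- cells counted by the coefficient of t^n q^m in F_v(t,q)
FvCoeff : ℕ → ℕ → Grid → Set
FvCoeff n m G =
  IsConvexPolyomino G × VerticallySymmetric G
  × halfPerimeter G ≡ n × area G ≡ m

-- Stack polyominoes. A stack polyomino is determined by the lengths of its
-- rows read from bottom to top (all rows start at the same leftmost column).

Stack : Set
Stack = List ℕ

Unimodal : List ℕ → Set
Unimodal ls = Σ (List ℕ) λ ys → Σ (List ℕ) λ zs →
  ls ≡ ys List.++ zs × Linked _≤_ ys × Linked _≥_ zs

IsStack : Stack → Set
IsStack ls = 1 ≤ length ls × All (1 ≤_) ls × Unimodal ls

stackWidth : Stack → ℕ
stackWidth ls = List.foldr _⊔_ 0 ls

stackHeight : Stack → ℕ
stackHeight ls = length ls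

stackArea : Stack → ℕ
stackArea ls = ListAction.sum ls

-- stacks contributing x^w y^h q^a to T(t^2, t, q^2) at t^n q^m:
--   2w + h = n, 2a = m
TCoeff₁ : ℕ → ℕ → Stack → Set
TCoeff₁ n m s = IsStack s
  × 2 * stackWidth s + stackHeight s ≡ n × 2 * stackArea s ≡ m

-- stacks contributing to (1/t) T(t^2, t/q, q^2) at t^n q^m:
--   2w + h - 1 = n, 2a - h = m  (note 2a ≥ h always)
TCoeff₂ : ℕ → ℕ → Stack → Set
TCoeff₂ n m s = IsStack s
  × 2 * stackWidth s + stackHeight s ≡ suc n
  × 2 * stackArea s ≡ m + stackHeight s

-- A convex polyomino invariant under the vertical reflection has symmetric convex rows, so
-- each row is the interval leaving the same margin a on both sides. With W = ⌈w/2⌉ and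
-- e = w mod 2 (so w = 2W − e), replacing a row by its half-length ℓ = W − a turns the
-- polyomino into a stack of width W: every row is nonempty because the bottom and top
-- rows meet the centre column, the row touching the left side has half-length W, and
-- column convexity of centred rows says exactly that the half-lengths have no valley,
-- i.e. are unimodal. Conversely every stack, for either parity e, is read back this way.
-- A row of half-length ℓ has 2ℓ − e cells, so the half-perimeter is 2W + h − e and the
-- area 2A − h·e: even widths give the terms of T(t², t, q²) and odd widths those of
-- t⁻¹ T(t², t/q, q²). Both sides are finite sets, counted by enumerating bounded lists.
module Submission where

open import Defs
open import Data.Bool using (Bool; true; false; _∧_)
open import Data.Bool.Properties using (⇔→≡)
open import Data.Empty using (⊥)
open import Data.Fin using (Fin; toℕ; fromℕ; fromℕ<; inject₁; opposite)
  renaming (zero to fzero; suc to fsuc)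
open import Data.Fin.Properties using (toℕ<n; toℕ-fromℕ<; toℕ-injective; opposite-prop; opposite-involutive)
  renaming (≤-total to ≤ᶠ-total)
open import Data.List using (List; []; _∷_; [_]; length; map; _++_; filter; deduplicate; upTo; cartesianProductWith)
open import Data.List.Membership.Propositional using (_∈_)
open import Data.List.Membership.Propositional.Properties
  using (∈-filter⁺; ∈-filter⁻; ∈-deduplicate⁺; ∈-deduplicate⁻; ∈-map⁺; ∈-map⁻;
         ∈-++⁺ˡ; ∈-++⁺ʳ; ∈-++⁻; ∈-cartesianProductWith⁺; ∈-upTo⁺)
import Data.List.Properties as Listₚ
open import Data.List.Relation.Unary.All as All using (All; []; _∷_; all?)
open import Data.List.Relation.Unary.Any using (here; there)
open import Data.List.Relation.Unary.Linked using (Linked; []; [-]; _∷_; linked?)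
open import Data.List.Relation.Unary.Unique.Propositional using (Unique)
import Data.List.Relation.Unary.Unique.Propositional.Properties as Unique
open import Data.List.Relation.Unary.Unique.DecPropositional.Properties using (deduplicate-!)
open import Data.Nat using (ℕ; zero; suc; pred; _+_; _*_; _∸_; _≤_; _<_; z≤n; s≤s; s≤s⁻¹; >-nonZero;
                            _≤?_; _≥?_; _≟_; _<ᵇ_; ⌈_/2⌉; _%_)
open import Data.Nat.DivMod using (m%n<n)
open import Data.Nat.ListAction using (sum)
open import Data.Nat.Properties
open import Algebra.Properties.CommutativeSemigroup +-commutativeSemigroup using (interchange)
open import Data.Product using (Σ; _×_; _,_; proj₁; proj₂; ∃; ∃₂)
open import Data.Sum as Sum using (_⊎_; inj₁; inj₂; [_,_]′)
open import Data.Sum.Properties using (inj₁-injective; inj₂-injective)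
open import Data.Vec as Vec using (Vec; []; _∷_; lookup; tabulate; reverse; _∷ʳ_; fromList; toList)
open import Data.Vec.Properties
  using (reverse-∷; lookup∘tabulate; tabulate∘lookup; tabulate-cong; lookup-map; map-∘; map-cong;
         toList∘fromList; length-toList)
open import Function using (_∘_)
open import Function.Bundles using (_⇔_; mk⇔; Equivalence)
open import Relation.Binary.Definitions using (DecidableEquality; Reflexive; Transitive)
open import Relation.Binary.PropositionalEquality
  using (_≡_; refl; sym; trans; cong; cong₂; subst; subst₂; module ≡-Reasoning)
open import Relation.Nullary using (yes; no; contradiction)
open import Relation.Nullary.Decidable using (_×-dec_)
open import Relation.Nullary.Reflects using (Reflects; ofʸ; ofⁿ; _×-reflects_)
open import Relation.Unary using (Decidable)

-- Counting

module _ {A : Set} {P : A → Set} where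

  hasCount-enumerate : DecidableEquality A → Decidable P → (xs : List A) →
                       (∀ {x} → P x → x ∈ xs) → ∃ (HasCount P)
  hasCount-enumerate _≟ₐ_ P? xs complete =
    length ys , ys , deduplicate-! _≟ₐ_ (filter P? xs) , refl , λ x → mk⇔ sound (adequate x)
    where
    ys = deduplicate _≟ₐ_ (filter P? xs)
    sound : ∀ {x} → x ∈ ys → P x
    sound x∈ys = proj₂ (∈-filter⁻ P? {xs = xs} (∈-deduplicate⁻ _≟ₐ_ (filter P? xs) x∈ys))
    adequate : ∀ x → P x → x ∈ ys
    adequate x px = ∈-deduplicate⁺ _≟ₐ_ (∈-filter⁺ P? (complete px) px)

module _ {A B : Set} {P : A → Set} {Q : B → Set} where

  hasCount-⊎ : ∀ {k l} → HasCount P k → HasCount Q l → HasCount [ P , Q ]′ (k + l)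
  hasCount-⊎ (xs , xs! , refl , xs≡P) (ys , ys! , refl , ys≡Q) =
    zs , Unique.++⁺ (Unique.map⁺ inj₁-injective xs!) (Unique.map⁺ inj₂-injective ys!) disjoint ,
    trans (Listₚ.length-++ (map inj₁ xs))
          (cong₂ _+_ (Listₚ.length-map inj₁ xs) (Listₚ.length-map inj₂ ys)) ,
    λ z → mk⇔ (sound z) (adequate z)
    where
    zs = map inj₁ xs ++ map inj₂ ys
    disjoint : ∀ {z} → z ∈ map inj₁ xs × z ∈ map inj₂ ys → ⊥
    disjoint (z∈xs , z∈ys) with ∈-map⁻ inj₁ z∈xs | ∈-map⁻ inj₂ z∈ys
    ... | _ , _ , refl | _ , _ , ()
    sound : ∀ z → z ∈ zs → [ P , Q ]′ z
    sound z z∈zs with ∈-++⁻ (map inj₁ xs) z∈zs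
    ... | inj₁ z∈xs with ∈-map⁻ inj₁ z∈xs
    ...   | x , x∈xs , refl = Equivalence.to (xs≡P x) x∈xs
    sound z z∈zs | inj₂ z∈ys with ∈-map⁻ inj₂ z∈ys
    ...   | y , y∈ys , refl = Equivalence.to (ys≡Q y) y∈ys
    adequate : ∀ z → [ P , Q ]′ z → z ∈ zs
    adequate (inj₁ x) px = ∈-++⁺ˡ (∈-map⁺ inj₁ (Equivalence.from (xs≡P x) px))
    adequate (inj₂ y) qy = ∈-++⁺ʳ (map inj₁ xs) (∈-map⁺ inj₂ (Equivalence.from (ys≡Q y) qy))

  hasCount-inverse : ∀ {k} (f : A → B) (g : B → A) →
                     (∀ {x} → P x → Q (f x)) → (∀ {y} → Q y → P (g y)) →
                     (∀ {x} → P x → g (f x) ≡ x) → (∀ {y} → Q y → f (g y) ≡ y) →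
                     HasCount P k → HasCount Q k
  hasCount-inverse f g f∈Q g∈P gf≡id fg≡id (xs , xs! , refl , xs≡P) =
    map f xs , Unique.map⁻ (subst Unique (sym g∘f-xs) xs!) , Listₚ.length-map f xs ,
    λ y → mk⇔ sound (adequate y)
    where
    g∘f-xs : map g (map f xs) ≡ xs
    g∘f-xs = trans (sym (Listₚ.map-∘ xs))
                   (Listₚ.map-id-local (All.tabulate (gf≡id ∘ Equivalence.to (xs≡P _))))
    sound : ∀ {y} → y ∈ map f xs → Q y
    sound y∈fxs with ∈-map⁻ f y∈fxs
    ... | x , x∈xs , refl = f∈Q (Equivalence.to (xs≡P x) x∈xs)
    adequate : ∀ y → Q y → y ∈ map f xs
    adequate y qy = subst (_∈ map f xs) (fg≡id qy) (∈-map⁺ f (Equivalence.from (xs≡P (g y)) (g∈P qy)))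

-- Stacks

boundedLists : ℕ → ℕ → List (List ℕ)
boundedLists zero    N = [ [] ]
boundedLists (suc L) N = [] ∷ cartesianProductWith _∷_ (upTo (suc N)) (boundedLists L N)

∈-boundedLists : ∀ {L N xs} → length xs ≤ L → All (_≤ N) xs → xs ∈ boundedLists L N
∈-boundedLists {zero}  {xs = []}     _         _            = here refl
∈-boundedLists {suc L} {xs = []}     _         _            = here refl
∈-boundedLists {suc L} {xs = x ∷ xs} (s≤s len) (x≤N ∷ xs≤N) =
  there (∈-cartesianProductWith⁺ _∷_ (∈-upTo⁺ (s≤s x≤N)) (∈-boundedLists len xs≤N))

split? : {A : Set} {P Q : List A → Set} → Decidable P → Decidable Q →
         Decidable (λ xs → ∃₂ λ ys zs → xs ≡ ys ++ zs × P ys × Q zs)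
split? P? Q? xs with P? [] ×-dec Q? xs
... | yes (p , q) = yes ([] , xs , refl , p , q)
split? P? Q? []       | no ¬pq = no λ { ([] , [] , refl , pq) → ¬pq pq }
split? P? Q? (x ∷ xs) | no ¬pq with split? (P? ∘ (x ∷_)) Q? xs
... | yes (ys , zs , refl , pq) = yes (x ∷ ys , zs , refl , pq)
... | no ¬split = no λ { ([] , _ , refl , pq) → ¬pq pq
                       ; (_ ∷ ys , zs , refl , pq) → ¬split (ys , zs , refl , pq) }

unimodal? : Decidable Unimodal
unimodal? = split? (linked? _≤?_) (linked? _≥?_)

isStack? : Decidable IsStack
isStack? s = 1 ≤? length s ×-dec all? (1 ≤?_) s ×-dec unimodal? s

-- Positions past the end read as 0.
at : List ℕ → ℕ → ℕ
at []       _       = 0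
at (x ∷ xs) zero    = x
at (x ∷ xs) (suc i) = at xs i

at-++ˡ : ∀ ys {zs i} → i < length ys → at (ys ++ zs) i ≡ at ys i
at-++ˡ (y ∷ ys) {i = zero}  _        = refl
at-++ˡ (y ∷ ys) {i = suc i} (s≤s lt) = at-++ˡ ys lt

at-++ʳ : ∀ ys {zs i} → length ys ≤ i → at (ys ++ zs) i ≡ at zs (i ∸ length ys)
at-++ʳ []                    _        = refl
at-++ʳ (y ∷ ys) {i = suc i} (s≤s le) = at-++ʳ ys le

All-at : ∀ {P : ℕ → Set} {xs} → All P xs → ∀ {i} → i < length xs → P (at xs i)
All-at (px ∷ _)   {zero}  _        = px
All-at (_ ∷ pxs) {suc i} (s≤s lt) = All-at pxs lt

lookup-fromList : ∀ (s : List ℕ) i → lookup (fromList s) i ≡ at s (toℕ i)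
lookup-fromList (x ∷ s) fzero    = refl
lookup-fromList (x ∷ s) (fsuc i) = lookup-fromList s i

at-toList : ∀ {n} (v : Vec ℕ n) i → at (toList v) (toℕ i) ≡ lookup v i
at-toList (x ∷ v) fzero    = refl
at-toList (x ∷ v) (fsuc i) = at-toList v i

All-toList : ∀ {A : Set} {P : A → Set} {n} (v : Vec A n) → (∀ i → P (lookup v i)) → All P (toList v)
All-toList []      _ = []
All-toList (x ∷ v) p = p fzero ∷ All-toList v (p ∘ fsuc)

Σ-fromList∘toList : ∀ {A : Set} {n} (v : Vec A n) →
                    _≡_ {A = Σ ℕ (Vec A)} (length (toList v) , fromList (toList v)) (n , v)
Σ-fromList∘toList []      = refl
Σ-fromList∘toList (x ∷ v) = cong (λ (n , u) → suc n , x ∷ u) (Σ-fromList∘toList v)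

module _ {R : ℕ → ℕ → Set} where

  Linked⇒at-mono : Reflexive R → Transitive R → ∀ {xs i k} → Linked R xs →
                   i ≤ k → k < length xs → R (at xs i) (at xs k)
  Linked⇒at-mono refl′ trans′ {x ∷ xs}     {zero}  {zero}  _         _        _        = refl′
  Linked⇒at-mono refl′ trans′ {x ∷ y ∷ xs} {zero}  {suc k} (r ∷ xs↗) _        (s≤s lt) =
    trans′ r (Linked⇒at-mono refl′ trans′ xs↗ z≤n lt)
  Linked⇒at-mono refl′ trans′ {x ∷ y ∷ xs} {suc i} {suc k} (_ ∷ xs↗) (s≤s le) (s≤s lt) =
    Linked⇒at-mono refl′ trans′ xs↗ le lt
  Linked⇒at-mono refl′ trans′ {x ∷ []}     {k = suc k}     _         _        (s≤s ())

  at-steps⇒Linked : ∀ {xs} → (∀ {i} → suc i < length xs → R (at xs i) (at xs (suc i))) → Linked R xs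
  at-steps⇒Linked {[]}         _    = []
  at-steps⇒Linked {x ∷ []}     _    = [-]
  at-steps⇒Linked {x ∷ y ∷ xs} next = next (s≤s (s≤s z≤n)) ∷ at-steps⇒Linked (λ lt → next (s≤s lt))

NoValley : List ℕ → Set
NoValley xs = ∀ {i k l} → i ≤ k → k ≤ l → l < length xs → at xs i ≤ at xs k ⊎ at xs l ≤ at xs k

unimodal⇒noValley : ∀ {xs} → Unimodal xs → NoValley xs
unimodal⇒noValley (ys , zs , refl , ys↗ , zs↘) {i} {k} {l} i≤k k≤l l<len with k <? length ys
... | yes k<n = inj₁ (subst₂ _≤_ (sym (at-++ˡ ys (≤-<-trans i≤k k<n))) (sym (at-++ˡ ys k<n))
                        (Linked⇒at-mono ≤-refl ≤-trans ys↗ i≤k k<n))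
... | no k≮n  = inj₂ (subst₂ _≤_ (sym (at-++ʳ ys (≤-trans n≤k k≤l))) (sym (at-++ʳ ys n≤k))
                        (Linked⇒at-mono ≤-refl (λ p q → ≤-trans q p) zs↘ (∸-monoˡ-≤ n k≤l) l∸n<len))
  where
  n = length ys
  n≤k = ≮⇒≥ k≮n
  l∸n<len : l ∸ n < length zs
  l∸n<len = subst (l ∸ n <_) (m+n∸m≡n n (length zs))
                  (∸-monoˡ-< (subst (l <_) (Listₚ.length-++ ys) l<len) (≤-trans n≤k k≤l))

All-≤-stackWidth : ∀ xs → All (_≤ stackWidth xs) xs
All-≤-stackWidth []       = []
All-≤-stackWidth (x ∷ xs) = m≤m⊔n x _ ∷ All.map (m≤n⇒m≤o⊔n x) (All-≤-stackWidth xs)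

stackWidth-≤ : ∀ {W xs} → All (_≤ W) xs → stackWidth xs ≤ W
stackWidth-≤ = Listₚ.foldr-preservesᵇ ⊔-lub z≤n

stackWidth-attained : ∀ {xs} → 0 < length xs → ∃ λ r → r < length xs × at xs r ≡ stackWidth xs
stackWidth-attained {x ∷ []}     _ = 0 , s≤s z≤n , sym (⊔-identityʳ x)
stackWidth-attained {x ∷ y ∷ xs} _
  with stackWidth-attained {y ∷ xs} (s≤s z≤n) | ≤-total x (stackWidth (y ∷ xs))
... | r , r<len , at-r≡max | inj₁ x≤max = suc r , s≤s r<len , trans at-r≡max (sym (m≤n⇒m⊔n≡n x≤max))
... | _                    | inj₂ x≥max = 0 , s≤s z≤n , sym (m≥n⇒m⊔n≡m x≥max)

peak⇒unimodal : ∀ xs r →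
                (∀ {i} → suc i ≤ r → suc i < length xs → at xs i ≤ at xs (suc i)) →
                (∀ {i} → r ≤ i → suc i < length xs → at xs (suc i) ≤ at xs i) →
                Unimodal xs
peak⇒unimodal xs       zero    _      falling = [] , xs , refl , [] , at-steps⇒Linked (falling z≤n)
peak⇒unimodal []       (suc r) _      _       = [] , [] , refl , [] , []
peak⇒unimodal (x ∷ xs) (suc r) rising falling
  with peak⇒unimodal xs r (λ le lt → rising (s≤s le) (s≤s lt)) (λ le lt → falling (s≤s le) (s≤s lt))
... | []     , zs , refl , _   , zs↘ = [ x ] , zs , refl , [-] , zs↘
... | y ∷ ys , zs , refl , ys↗ , zs↘ =
  x ∷ y ∷ ys , zs , refl , rising (s≤s z≤n) (s≤s (s≤s z≤n)) ∷ ys↗ , zs↘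

noValley⇒unimodal : ∀ {xs} → NoValley xs → Unimodal xs
noValley⇒unimodal {[]}     _        = [] , [] , refl , [] , []
noValley⇒unimodal {x ∷ xs} noValley with stackWidth-attained {x ∷ xs} (s≤s z≤n)
... | r , r<len , at-r≡max = peak⇒unimodal (x ∷ xs) r rising falling
  where
  ≤peak : ∀ {i} → i < length (x ∷ xs) → at (x ∷ xs) i ≤ at (x ∷ xs) r
  ≤peak i<len = subst (_ ≤_) (sym at-r≡max) (All-at (All-≤-stackWidth (x ∷ xs)) i<len)
  rising : ∀ {i} → suc i ≤ r → suc i < length (x ∷ xs) → at (x ∷ xs) i ≤ at (x ∷ xs) (suc i)
  rising {i} le lt with noValley (n≤1+n i) le r<len
  ... | inj₁ ok    = ok
  ... | inj₂ peak≤ = ≤-trans (≤peak (<-trans (n<1+n i) lt)) peak≤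
  falling : ∀ {i} → r ≤ i → suc i < length (x ∷ xs) → at (x ∷ xs) (suc i) ≤ at (x ∷ xs) i
  falling {i} le lt with noValley le (n≤1+n i) lt
  ... | inj₁ peak≤ = ≤-trans (≤peak lt) peak≤
  ... | inj₂ ok    = ok

∈-boundedLists-stack : ∀ {N s} → 2 * stackWidth s + stackHeight s ≤ N → s ∈ boundedLists N N
∈-boundedLists-stack {N} {s} 2W+h≤N = ∈-boundedLists (≤-trans (m≤n+m (length s) (2 * W)) 2W+h≤N)
  (All.map (λ x≤W → ≤-trans x≤W W≤N) (All-≤-stackWidth s))
  where
  W = stackWidth s
  W≤N = ≤-trans (m≤m+n W _) (≤-trans (m≤m+n (2 * W) _) 2W+h≤N)

hasCount-TCoeff₁ : ∀ n m → ∃ (HasCount (TCoeff₁ n m))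
hasCount-TCoeff₁ n m =
  hasCount-enumerate (Listₚ.≡-dec _≟_) (λ s → isStack? s ×-dec (_ ≟ n) ×-dec (_ ≟ m))
    (boundedLists (suc n) (suc n))
    (λ (_ , 2W+h≡n , _) → ∈-boundedLists-stack (≤-trans (≤-reflexive 2W+h≡n) (n≤1+n n)))

hasCount-TCoeff₂ : ∀ n m → ∃ (HasCount (TCoeff₂ n m))
hasCount-TCoeff₂ n m =
  hasCount-enumerate (Listₚ.≡-dec _≟_) (λ s → isStack? s ×-dec (_ ≟ suc n) ×-dec (_ ≟ m + length s))
    (boundedLists (suc n) (suc n)) (λ (_ , 2W+h≡1+n , _) → ∈-boundedLists-stack (≤-reflexive 2W+h≡1+n))

-- Rows

Reflects⇒≡true⇔ : ∀ {A : Set} {b} → Reflects A b → b ≡ true ⇔ A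
Reflects⇒≡true⇔ (ofʸ a)  = mk⇔ (λ _ → a) (λ _ → refl)
Reflects⇒≡true⇔ (ofⁿ ¬a) = mk⇔ (λ ()) (λ a → contradiction a ¬a)

lookup-ext : ∀ {A : Set} {n} {u v : Vec A n} → (∀ i → lookup u i ≡ lookup v i) → u ≡ v
lookup-ext {u = u} {v} eq = trans (sym (tabulate∘lookup u)) (trans (tabulate-cong eq) (tabulate∘lookup v))

lookup-∷ʳ-last : ∀ {A : Set} {n} (v : Vec A n) x → lookup (v ∷ʳ x) (fromℕ n) ≡ x
lookup-∷ʳ-last []      x = refl
lookup-∷ʳ-last (_ ∷ v) x = lookup-∷ʳ-last v x

lookup-∷ʳ-inject₁ : ∀ {A : Set} {n} (v : Vec A n) x i → lookup (v ∷ʳ x) (inject₁ i) ≡ lookup v i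
lookup-∷ʳ-inject₁ (_ ∷ v) x fzero    = refl
lookup-∷ʳ-inject₁ (_ ∷ v) x (fsuc i) = lookup-∷ʳ-inject₁ v x i

lookup-reverse-opposite : ∀ {A : Set} {n} (v : Vec A n) i → lookup (reverse v) (opposite i) ≡ lookup v i
lookup-reverse-opposite (x ∷ v) fzero    =
  trans (cong (λ u → lookup u (fromℕ _)) (reverse-∷ x v)) (lookup-∷ʳ-last (reverse v) x)
lookup-reverse-opposite (x ∷ v) (fsuc i) =
  trans (cong (λ u → lookup u (inject₁ (opposite i))) (reverse-∷ x v))
        (trans (lookup-∷ʳ-inject₁ (reverse v) x (opposite i)) (lookup-reverse-opposite v i))

lookup-reverse : ∀ {A : Set} {n} (v : Vec A n) i → lookup (reverse v) i ≡ lookup v (opposite i)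
lookup-reverse v i =
  trans (cong (lookup (reverse v)) (sym (opposite-involutive i))) (lookup-reverse-opposite v (opposite i))

suc-toℕ+toℕ-opposite : ∀ {w} (j : Fin w) → suc (toℕ j + toℕ (opposite j)) ≡ w
suc-toℕ+toℕ-opposite j = trans (cong (λ x → suc (toℕ j + x)) (opposite-prop j)) (m+[n∸m]≡n (toℕ<n j))

≤opposite⇔ : ∀ {w m} (j : Fin w) → m ≤ toℕ (opposite j) ⇔ m + suc (toℕ j) ≤ w
≤opposite⇔ {w} {m} j = mk⇔
  (λ le → m≤o∸n⇒m+n≤o m (toℕ<n j) (subst (m ≤_) (opposite-prop j) le))
  (λ le → subst (m ≤_) (sym (opposite-prop j)) (m+n≤o⇒m≤o∸n m le))

≤-opposite : ∀ {w} (i j : Fin w) → toℕ i ≤ toℕ (opposite j) → toℕ j ≤ toℕ (opposite i)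
≤-opposite {w} i j le =
  Equivalence.from (≤opposite⇔ i) (subst (_≤ w) i+1+j≡j+1+i (Equivalence.to (≤opposite⇔ j) le))
  where
  i+1+j≡j+1+i = trans (+-suc (toℕ i) (toℕ j))
                      (trans (cong suc (+-comm (toℕ i) (toℕ j))) (sym (+-suc (toℕ j) (toℕ i))))

opposite-anti : ∀ {w} {k l : Fin w} → toℕ k ≤ toℕ l → toℕ (opposite l) ≤ toℕ (opposite k)
opposite-anti {w} {k} {l} k≤l =
  subst₂ _≤_ (sym (opposite-prop l)) (sym (opposite-prop k)) (∸-monoʳ-≤ w (s≤s k≤l))

<∸⇔≤opposite : ∀ {w a} (j : Fin w) → toℕ j < w ∸ a ⇔ a ≤ toℕ (opposite j)
<∸⇔≤opposite {w} {a} j = mk⇔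
  (λ lt → Equivalence.from (≤opposite⇔ j)
            (subst (_≤ w) (+-comm (suc (toℕ j)) a) (m≤o∸n⇒m+n≤o (suc (toℕ j)) (a≤w lt) lt)))
  (λ le → m+n≤o⇒m≤o∸n (suc (toℕ j))
            (subst (_≤ w) (+-comm a (suc (toℕ j))) (Equivalence.to (≤opposite⇔ j) le)))
  where
  a≤w : toℕ j < w ∸ a → a ≤ w
  a≤w lt = <⇒≤ (m∸n≢0⇒n<m (λ w∸a≡0 → contradiction (subst (toℕ j <_) w∸a≡0 lt) λ ()))

Inner : ∀ {w} → ℕ → Fin w → Set
Inner a j = a ≤ toℕ j × a ≤ toℕ (opposite j)

Inner-opposite : ∀ {w a} (j : Fin w) → Inner a j → Inner a (opposite j)
Inner-opposite {a = a} j (a≤j , a≤j′) = a≤j′ , subst (a ≤_) (cong toℕ (sym (opposite-involutive j))) a≤j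

Inner-mono : ∀ {w a b} {j : Fin w} → a ≤ b → Inner b j → Inner a j
Inner-mono a≤b (b≤j , b≤j′) = ≤-trans a≤b b≤j , ≤-trans a≤b b≤j′

Inner⇒+< : ∀ {w a} (j : Fin w) → Inner a j → a + a < w
Inner⇒+< j (a≤j , a≤j′) = ≤-trans (s≤s (+-mono-≤ a≤j a≤j′)) (≤-reflexive (suc-toℕ+toℕ-opposite j))

cellCount : ∀ {w} → Vec Bool w → ℕ
cellCount r = Vec.sum (Vec.map b2n r)

-- Both ends are tested with _<ᵇ_ so that shifting a, b and j by one is a definitional step.
interval : ℕ → ℕ → ℕ → Bool
interval a b j = (j <ᵇ b) ∧ (a <ᵇ suc j)

interval-true : ∀ a b j → interval a b j ≡ true ⇔ (a ≤ j × j < b)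
interval-true a b j with Reflects⇒≡true⇔ (<ᵇ-reflects-< j b ×-reflects <ᵇ-reflects-< a (suc j))
... | iff = mk⇔ (λ eq → let (j<b , a<1+j) = Equivalence.to iff eq in s≤s⁻¹ a<1+j , j<b)
                (λ (a≤j , j<b) → Equivalence.from iff (j<b , s≤s a≤j))

cellCount-interval : ∀ w a b → b ≤ w → cellCount (tabulate {n = w} λ j → interval a b (toℕ j)) ≡ b ∸ a
cellCount-interval zero    a       zero    _         = sym (0∸n≡0 a)
cellCount-interval (suc w) a       zero    _         = cellCount-interval w a zero z≤n
cellCount-interval (suc w) zero    (suc b) (s≤s b≤w) = cong suc (cellCount-interval w zero b b≤w)
cellCount-interval (suc w) (suc a) (suc b) (s≤s b≤w) = cellCount-interval w a b b≤w

centredRow : (w a : ℕ) → Vec Bool w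
centredRow w a = tabulate λ j → interval a (w ∸ a) (toℕ j)

cellCount-centredRow : ∀ w a → cellCount (centredRow w a) ≡ w ∸ a ∸ a
cellCount-centredRow w a = cellCount-interval w a (w ∸ a) (m∸n≤m w a)

centredRow-true : ∀ {w a} (j : Fin w) → lookup (centredRow w a) j ≡ true ⇔ Inner a j
centredRow-true {w} {a} j = mk⇔
  (λ eq → let (a≤j , j<w∸a) = Equivalence.to in-interval (trans (sym (lookup∘tabulate _ j)) eq)
          in a≤j , Equivalence.to (<∸⇔≤opposite j) j<w∸a)
  (λ (a≤j , a≤j′) → trans (lookup∘tabulate _ j)
     (Equivalence.from in-interval (a≤j , Equivalence.from (<∸⇔≤opposite j) a≤j′)))
  where in-interval = interval-true a (w ∸ a) (toℕ j)

reverse-centredRow : ∀ w a → reverse (centredRow w a) ≡ centredRow w a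
reverse-centredRow w a = lookup-ext λ j → trans (lookup-reverse (centredRow w a) j) (⇔→≡ (mk⇔
  (λ eq → from j (subst (Inner a) (opposite-involutive j) (Inner-opposite (opposite j) (to (opposite j) eq))))
  (λ eq → from (opposite j) (Inner-opposite j (to j eq)))))
  where
  to   = λ j → Equivalence.to (centredRow-true {w} {a} j)
  from = λ j → Equivalence.from (centredRow-true {w} {a} j)

ConvexRow : ∀ {w} → Vec Bool w → Set
ConvexRow {w} r = ∀ (j k l : Fin w) → lookup r j ≡ true → lookup r l ≡ true →
                  toℕ j ≤ toℕ k → toℕ k ≤ toℕ l → lookup r k ≡ true

centredRow-convex : ∀ w a → ConvexRow (centredRow w a)
centredRow-convex w a j k l rj rl j≤k k≤l
  with Equivalence.to (centredRow-true {w} {a} j) rj | Equivalence.to (centredRow-true {w} {a} l) rl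
... | a≤j , _ | _ , a≤l′ =
  Equivalence.from (centredRow-true k) (≤-trans a≤j j≤k , ≤-trans a≤l′ (opposite-anti k≤l))

marginCell : ∀ {w} a → a + a < w → Fin w
marginCell a a+a<w = fromℕ< (≤-<-trans (m≤m+n a a) a+a<w)

toℕ-marginCell : ∀ {w} a (a+a<w : a + a < w) → toℕ (marginCell a a+a<w) ≡ a
toℕ-marginCell a a+a<w = toℕ-fromℕ< (≤-<-trans (m≤m+n a a) a+a<w)

Inner-marginCell : ∀ {w} a (a+a<w : a + a < w) → Inner a (marginCell a a+a<w)
Inner-marginCell {w} a a+a<w = ≤-reflexive (sym q≡a) , Equivalence.from (≤opposite⇔ (marginCell a a+a<w))
  (subst (λ x → a + suc x ≤ w) (sym q≡a) (subst (_≤ w) (sym (+-suc a a)) a+a<w))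
  where q≡a = toℕ-marginCell a a+a<w

firstTrue : ∀ {w} → Vec Bool w → ℕ
firstTrue []          = 0
firstTrue (true  ∷ _) = 0
firstTrue (false ∷ r) = suc (firstTrue r)

firstTrue-≤ : ∀ {w} (r : Vec Bool w) j → lookup r j ≡ true → firstTrue r ≤ toℕ j
firstTrue-≤ (true  ∷ r) j        _  = z≤n
firstTrue-≤ (false ∷ r) (fsuc j) eq = s≤s (firstTrue-≤ r j eq)

firstTrue-true : ∀ {w} (r : Vec Bool w) (lt : firstTrue r < w) → lookup r (fromℕ< lt) ≡ true
firstTrue-true (true  ∷ r) _        = refl
firstTrue-true (false ∷ r) (s≤s lt) = firstTrue-true r lt

firstTrue-centredRow : ∀ {w a} → a + a < w → firstTrue (centredRow w a) ≡ a
firstTrue-centredRow {w} {a} a+a<w = ≤-antisym p≤a a≤p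
  where
  p≤a : firstTrue (centredRow w a) ≤ a
  p≤a = subst (firstTrue (centredRow w a) ≤_) (toℕ-marginCell a a+a<w)
          (firstTrue-≤ (centredRow w a) _ (Equivalence.from (centredRow-true _) (Inner-marginCell a a+a<w)))
  p<w = ≤-<-trans p≤a (≤-<-trans (m≤m+n a a) a+a<w)
  a≤p : a ≤ firstTrue (centredRow w a)
  a≤p = subst (a ≤_) (toℕ-fromℕ< p<w)
          (proj₁ (Equivalence.to (centredRow-true _) (firstTrue-true (centredRow w a) p<w)))

lookup-opposite : ∀ {w} {r : Vec Bool w} → reverse r ≡ r → ∀ j → lookup r (opposite j) ≡ lookup r j
lookup-opposite {r = r} r-sym j = trans (sym (lookup-reverse r j)) (cong (λ v → lookup v j) r-sym)

-- The first filled cell and its mirror image bound the row; convexity fills everything in between.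
symmetric-convex⇒centredRow : ∀ {w} (r : Vec Bool w) → reverse r ≡ r → ConvexRow r →
                               r ≡ centredRow w (firstTrue r)
symmetric-convex⇒centredRow {w} r r-sym convex = lookup-ext λ j → ⇔→≡ (mk⇔
  (λ rj → Equivalence.from (centredRow-true j)
            (firstTrue-≤ r j rj , firstTrue-≤ r (opposite j) (trans (lookup-opposite r-sym j) rj)))
  (λ cj → filled j (Equivalence.to (centredRow-true j) cj)))
  where
  filled : ∀ j → Inner (firstTrue r) j → lookup r j ≡ true
  filled j (p≤j , p≤j′) = convex q j (opposite q) rq (trans (lookup-opposite r-sym q) rq)
                                 (subst (_≤ toℕ j) (sym q≡p) p≤j)
                                 (≤-opposite q j (subst (_≤ toℕ (opposite j)) (sym q≡p) p≤j′))
    where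
    p<w = ≤-<-trans p≤j (toℕ<n j)
    q = fromℕ< p<w
    q≡p = toℕ-fromℕ< p<w
    rq = firstTrue-true r p<w

-- Paths in grids

module _ {w h : ℕ} (g : Vec (Vec Bool w) h) where

  Adj-sym : ∀ {c d} → Adj g c d → Adj g d c
  Adj-sym (inj₁ (i≡ , inj₁ j+1≡)) = inj₁ (sym i≡ , inj₂ j+1≡)
  Adj-sym (inj₁ (i≡ , inj₂ j+1≡)) = inj₁ (sym i≡ , inj₁ j+1≡)
  Adj-sym (inj₂ (j≡ , inj₁ i+1≡)) = inj₂ (sym j≡ , inj₂ i+1≡)
  Adj-sym (inj₂ (j≡ , inj₂ i+1≡)) = inj₂ (sym j≡ , inj₁ i+1≡)

  Reach-target : ∀ {c d} → Reach g c d → Filled g d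
  Reach-target (here fd)     = fd
  Reach-target (step _ _ fd) = fd

  Reach-trans : ∀ {c d e} → Reach g c d → Reach g d e → Reach g c e
  Reach-trans r (here _)         = r
  Reach-trans r (step r′ adj fe) = step (Reach-trans r r′) adj fe

  Reach-sym : ∀ {c d} → Reach g c d → Reach g d c
  Reach-sym (here fc)       = here fc
  Reach-sym (step r adj fe) = Reach-trans (step (here fe) (Adj-sym adj) (Reach-target r)) (Reach-sym r)

  module Line {n} (line : Fin n → Fin h × Fin w)
              (adjacent : ∀ {x y} → suc (toℕ x) ≡ toℕ y → Adj g (line x) (line y))
              (convex : ∀ {j k x} → Filled g (line j) → Filled g (line k) →
                        toℕ j ≤ toℕ x → toℕ x ≤ toℕ k → Filled g (line x)) where

    private
      walk : ∀ {j} → Filled g (line j) → ∀ d k → toℕ j + d ≡ toℕ k → Filled g (line k) →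
             Reach g (line j) (line k)
      walk {j} fj zero k j+0≡k fk with toℕ-injective {i = j} {j = k} (trans (sym (+-identityʳ _)) j+0≡k)
      ... | refl = here fj
      walk {j} fj (suc d) k j+d+1≡k fk = step (walk fj d k′ (sym k′≡j+d) fk′) (adjacent k′+1≡k) fk
        where
        j+d<n : toℕ j + d < n
        j+d<n = <-trans (+-monoʳ-< (toℕ j) (n<1+n d)) (subst (_< n) (sym j+d+1≡k) (toℕ<n k))
        k′ = fromℕ< j+d<n
        k′≡j+d = toℕ-fromℕ< j+d<n
        k′+1≡k : suc (toℕ k′) ≡ toℕ k
        k′+1≡k = trans (cong suc k′≡j+d) (trans (sym (+-suc (toℕ j) d)) j+d+1≡k)
        fk′ = convex fj fk (subst (toℕ j ≤_) (sym k′≡j+d) (m≤m+n _ d))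
                           (subst (toℕ k′ ≤_) k′+1≡k (n≤1+n _))

    Reach-line : ∀ {j k} → Filled g (line j) → Filled g (line k) → Reach g (line j) (line k)
    Reach-line {j} {k} fj fk with ≤ᶠ-total j k
    ... | inj₁ j≤k = walk fj (toℕ k ∸ toℕ j) k (m+[n∸m]≡n j≤k) fk
    ... | inj₂ k≤j = Reach-sym (walk fk (toℕ j ∸ toℕ k) j (m+[n∸m]≡n k≤j) fj)

  column⇒EdgeConnected : (c : Fin w) → RowConvex g → (∀ i → Filled g (i , c)) → EdgeConnected g
  column⇒EdgeConnected c rowConvex column (i , j) (i′ , j′) fij fij′ =
    Reach-trans (Row.Reach-line i fij (column i))
      (Reach-trans (Column.Reach-line (column i) (column i′)) (Row.Reach-line i′ (column i′) fij′))
    where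
    module Row (i : Fin h) = Line (i ,_) (λ x+1≡y → inj₁ (refl , inj₁ x+1≡y))
                                  (λ fj fk j≤x x≤k → rowConvex i _ _ _ fj fk j≤x x≤k)
    module Column = Line (_, c) (λ x+1≡y → inj₂ (refl , inj₁ x+1≡y)) (λ _ _ _ _ → column _)

-- Centred grids

%2≤1 : ∀ w → w % 2 ≤ 1
%2≤1 w = s≤s⁻¹ (m%n<n w 2)

halving : ∀ w → w + w % 2 ≡ ⌈ w /2⌉ + ⌈ w /2⌉
halving zero          = refl
halving (suc zero)    = refl
halving (suc (suc w)) = cong suc (trans (cong suc (halving w)) (sym (+-suc ⌈ w /2⌉ ⌈ w /2⌉)))

halving-≤ : ∀ {w e e′ W W′} → e ≤ 1 → w + e ≡ W + W → w + e′ ≡ W′ + W′ → W ≤ W′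
halving-≤ {w} {e} {e′} {W} {W′} e≤1 eq eq′ = ≮⇒≥ λ W′<W → 1+n≰n (begin
  suc (suc w)          ≤⟨ s≤s (s≤s (m≤m+n w e′)) ⟩
  suc (suc (w + e′))   ≡⟨ cong (suc ∘ suc) eq′ ⟩
  suc (suc (W′ + W′))  ≡⟨ cong suc (+-suc W′ W′) ⟨
  suc W′ + suc W′      ≤⟨ +-mono-≤ W′<W W′<W ⟩
  W + W                ≡⟨ eq ⟨
  w + e                ≤⟨ +-monoʳ-≤ w e≤1 ⟩
  w + 1                ≡⟨ +-comm w 1 ⟩
  suc w                ∎)
  where open ≤-Reasoning

halving-unique : ∀ {w e W} → e ≤ 1 → w + e ≡ W + W → ⌈ w /2⌉ ≡ W × w % 2 ≡ e
halving-unique {w} {e} {W} e≤1 eq =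
  ⌈w/2⌉≡W , +-cancelˡ-≡ w _ _ (trans (halving w) (trans (cong₂ _+_ ⌈w/2⌉≡W ⌈w/2⌉≡W) (sym eq)))
  where
  ⌈w/2⌉≡W = ≤-antisym (halving-≤ (%2≤1 w) (halving w) eq) (halving-≤ e≤1 eq (halving w))

0<⌈n/2⌉ : ∀ {n} → 0 < n → 0 < ⌈ n /2⌉
0<⌈n/2⌉ {suc n} _ = s≤s z≤n

module _ {w h : ℕ} {g : Vec (Vec Bool w) h} where

  column-row⇒TightBox : (c : Fin w) (r : Fin h) → (∀ i → Filled g (i , c)) → (∀ j → Filled g (r , j)) →
                        TightBox g
  column-row⇒TightBox c r column row =
      ((bottom , c) , column bottom , toℕ-fromℕ< 0<h)
    , ((opposite bottom , c) , column _ , last bottom (toℕ-fromℕ< 0<h))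
    , ((r , left) , row left , toℕ-fromℕ< 0<w)
    , ((r , opposite left) , row _ , last left (toℕ-fromℕ< 0<w))
    where
    0<h = ≤-<-trans z≤n (toℕ<n r)
    0<w = ≤-<-trans z≤n (toℕ<n c)
    bottom = fromℕ< 0<h
    left = fromℕ< 0<w
    last : ∀ {n} (i : Fin n) → toℕ i ≡ 0 → suc (toℕ (opposite i)) ≡ n
    last i i≡0 = trans (cong (λ x → suc (x + toℕ (opposite i))) (sym i≡0)) (suc-toℕ+toℕ-opposite i)

-- A box of width w made of two halves of width W that overlap in e ≤ 1 columns.
module Halves {w W e : ℕ} (e≤1 : e ≤ 1) (w+e≡W+W : w + e ≡ W + W) (0<W : 0 < W) where

  w≤W+W : w ≤ W + W
  w≤W+W = subst (w ≤_) w+e≡W+W (m≤m+n w e)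

  W+W≤1+w : W + W ≤ suc w
  W+W≤1+w = subst (_≤ suc w) w+e≡W+W (subst (w + e ≤_) (+-comm w 1) (+-monoʳ-≤ w e≤1))

  <⇒+W≤ : ∀ {a} → a < W → a + W ≤ w
  <⇒+W≤ a<W = s≤s⁻¹ (≤-trans (+-monoˡ-≤ W a<W) W+W≤1+w)

  <⇒+< : ∀ {a} → a < W → a + a < w
  <⇒+< {a} a<W = <-≤-trans (+-monoʳ-< a a<W) (<⇒+W≤ a<W)

  +<⇒< : ∀ {a} → a + a < w → a < W
  +<⇒< a+a<w = ≰⇒> λ W≤a → <⇒≱ (<-≤-trans a+a<w w≤W+W) (+-mono-≤ W≤a W≤a)

  Inner⇒< : ∀ {a} (j : Fin w) → Inner a j → a < W
  Inner⇒< j inner = +<⇒< (Inner⇒+< j inner)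

  1+pred[W]≡W : suc (pred W) ≡ W
  1+pred[W]≡W = suc-pred W {{>-nonZero 0<W}}

  pred[W]<w : pred W < w
  pred[W]<w = ≤-<-trans (m≤m+n _ _) (<⇒+< (≤-reflexive 1+pred[W]≡W))

  centre : Fin w
  centre = fromℕ< pred[W]<w

  Inner-centre : ∀ {a} → a < W → Inner a centre
  Inner-centre {a} a<W = subst (a ≤_) (sym (toℕ-fromℕ< pred[W]<w)) (<⇒≤pred a<W) ,
    Equivalence.from (≤opposite⇔ centre)
      (subst (λ x → a + suc x ≤ w) (sym (toℕ-fromℕ< pred[W]<w))
        (subst (λ x → a + x ≤ w) (sym 1+pred[W]≡W) (<⇒+W≤ a<W)))

  centredRowCount : ∀ {a} → a < W → w ∸ a ∸ a + e ≡ (W ∸ a) + (W ∸ a)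
  centredRowCount {a} a<W = begin
    w ∸ a ∸ a + e      ≡⟨ cong (_+ e) (∸-+-assoc w a a) ⟩
    w ∸ (a + a) + e    ≡⟨ +-∸-comm e (<⇒≤ (<⇒+< a<W)) ⟨
    w + e ∸ (a + a)    ≡⟨ cong (_∸ (a + a)) w+e≡W+W ⟩
    W + W ∸ (a + a)    ≡⟨ ∸-+-assoc (W + W) a a ⟨
    W + W ∸ a ∸ a      ≡⟨ cong (_∸ a) (+-∸-comm W a≤W) ⟩
    (W ∸ a) + W ∸ a    ≡⟨ +-∸-assoc (W ∸ a) a≤W ⟩
    (W ∸ a) + (W ∸ a)  ∎
    where
    open ≡-Reasoning
    a≤W = <⇒≤ a<W

stackRows : (w W : ℕ) (s : Stack) → Vec (Vec Bool w) (length s)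
stackRows w W s = Vec.map (λ ℓ → centredRow w (W ∸ ℓ)) (fromList s)

rowLengths : ∀ {w h} → ℕ → Vec (Vec Bool w) h → Vec ℕ h
rowLengths W g = Vec.map (λ r → W ∸ firstTrue r) g

lookup-stackRows : ∀ w W s i → lookup (stackRows w W s) i ≡ centredRow w (W ∸ at s (toℕ i))
lookup-stackRows w W s i =
  trans (lookup-map i _ (fromList s)) (cong (λ ℓ → centredRow w (W ∸ ℓ)) (lookup-fromList s i))

stackRows-symmetric : ∀ w W s → Vec.map reverse (stackRows w W s) ≡ stackRows w W s
stackRows-symmetric w W s =
  trans (sym (map-∘ reverse _ (fromList s))) (map-cong (λ ℓ → reverse-centredRow w (W ∸ ℓ)) (fromList s))

stackRows-RowConvex : ∀ w W s → RowConvex (stackRows w W s)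
stackRows-RowConvex w W s i =
  subst ConvexRow (sym (lookup-stackRows w W s i)) (centredRow-convex w (W ∸ at s (toℕ i)))

module StackRows {w W e : ℕ} (e≤1 : e ≤ 1) (w+e≡W+W : w + e ≡ W + W) (0<W : 0 < W) where

  open Halves e≤1 w+e≡W+W 0<W public

  cellCount-stackRow : ∀ {ℓ} → 0 < ℓ → ℓ ≤ W → cellCount (centredRow w (W ∸ ℓ)) + e ≡ ℓ + ℓ
  cellCount-stackRow {ℓ} 0<ℓ ℓ≤W = begin
    cellCount (centredRow w (W ∸ ℓ)) + e  ≡⟨ cong (_+ e) (cellCount-centredRow w (W ∸ ℓ)) ⟩
    w ∸ (W ∸ ℓ) ∸ (W ∸ ℓ) + e             ≡⟨ centredRowCount (∸-monoʳ-< 0<ℓ ℓ≤W) ⟩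
    W ∸ (W ∸ ℓ) + (W ∸ (W ∸ ℓ))           ≡⟨ cong₂ _+_ (m∸[m∸n]≡n ℓ≤W) (m∸[m∸n]≡n ℓ≤W) ⟩
    ℓ + ℓ                                 ∎
    where open ≡-Reasoning

  area-stackRows : ∀ {s} → All (λ ℓ → 0 < ℓ × ℓ ≤ W) s →
                   Vec.sum (Vec.map cellCount (stackRows w W s)) + length s * e ≡ sum s + sum s
  area-stackRows {[]}    []                     = refl
  area-stackRows {ℓ ∷ s} ((0<ℓ , ℓ≤W) ∷ bounded) = begin
    (c + A) + (e + length s * e)  ≡⟨ interchange c A e (length s * e) ⟩
    (c + e) + (A + length s * e)  ≡⟨ cong₂ _+_ (cellCount-stackRow 0<ℓ ℓ≤W) (area-stackRows bounded) ⟩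
    (ℓ + ℓ) + (sum s + sum s)     ≡⟨ interchange ℓ ℓ (sum s) (sum s) ⟩
    (ℓ + sum s) + (ℓ + sum s)     ∎
    where
    open ≡-Reasoning
    c = cellCount (centredRow w (W ∸ ℓ))
    A = Vec.sum (Vec.map cellCount (stackRows w W s))

  module Bounded {s : Stack} (bounded : All (λ ℓ → 0 < ℓ × ℓ ≤ W) s) where

    rows : Vec (Vec Bool w) (length s)
    rows = stackRows w W s

    ℓ : Fin (length s) → ℕ
    ℓ i = at s (toℕ i)

    margin : Fin (length s) → ℕ
    margin i = W ∸ ℓ i

    ℓ≤W : ∀ i → ℓ i ≤ W
    ℓ≤W i = proj₂ (All-at bounded (toℕ<n i))

    margin<W : ∀ i → margin i < W
    margin<W i = ∸-monoʳ-< (proj₁ (All-at bounded (toℕ<n i))) (ℓ≤W i)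

    filled⇔ : ∀ {i j} → Filled rows (i , j) ⇔ Inner (margin i) j
    filled⇔ {i} {j} =
      subst (λ r → lookup r j ≡ true ⇔ Inner (margin i) j) (sym (lookup-stackRows w W s i)) (centredRow-true j)

    centre-filled : ∀ i → Filled rows (i , centre)
    centre-filled i = Equivalence.from filled⇔ (Inner-centre (margin<W i))

    full : ∀ {i} → ℓ i ≡ W → ∀ j → Filled rows (i , j)
    full ℓ≡W j = Equivalence.from filled⇔
      (Inner-mono (≤-reflexive (trans (cong (W ∸_) ℓ≡W) (n∸n≡0 W))) (z≤n , z≤n))

    edge : Fin (length s) → Fin w
    edge x = marginCell (margin x) (<⇒+< (margin<W x))

    Inner-edge : ∀ x → Inner (margin x) (edge x)
    Inner-edge x = Inner-marginCell (margin x) (<⇒+< (margin<W x))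

    wider-than-edge : ∀ x {k} → margin k ≤ toℕ (edge x) → ℓ x ≤ ℓ k
    wider-than-edge x margin≤ =
      ∸-cancelʳ-≤ (ℓ≤W x) (subst (margin _ ≤_) (toℕ-marginCell (margin x) (<⇒+< (margin<W x))) margin≤)

    NoValley⇒ColConvex : NoValley s → ColConvex rows
    NoValley⇒ColConvex noValley i k l j fi fl i≤k k≤l with noValley i≤k k≤l (toℕ<n l)
    ... | inj₁ ℓi≤ℓk = Equivalence.from filled⇔
                         (Inner-mono (∸-monoʳ-≤ W ℓi≤ℓk) (Equivalence.to filled⇔ fi))
    ... | inj₂ ℓl≤ℓk = Equivalence.from filled⇔
                         (Inner-mono (∸-monoʳ-≤ W ℓl≤ℓk) (Equivalence.to filled⇔ fl))

    -- If row i is not wider than row l, the left end of row i lies in row l,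
    -- hence in every row between them.
    ColConvex⇒NoValley : ColConvex rows → NoValley s
    ColConvex⇒NoValley colConvex {i} {k} {l} i≤k k≤l l<len =
      Sum.map (subst₂ _≤_ (ℓ-fromℕ< i<len) (ℓ-fromℕ< k<len))
              (subst₂ _≤_ (ℓ-fromℕ< l<len) (ℓ-fromℕ< k<len))
        (noValley (subst₂ _≤_ (sym (toℕ-fromℕ< i<len)) (sym (toℕ-fromℕ< k<len)) i≤k)
                  (subst₂ _≤_ (sym (toℕ-fromℕ< k<len)) (sym (toℕ-fromℕ< l<len)) k≤l))
      where
      k<len = ≤-<-trans k≤l l<len
      i<len = ≤-<-trans i≤k k<len
      ℓ-fromℕ< : ∀ {x} (x<len : x < length s) → ℓ (fromℕ< x<len) ≡ at s x
      ℓ-fromℕ< x<len = cong (at s) (toℕ-fromℕ< x<len)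
      between : ∀ i k l {j} → toℕ i ≤ toℕ k → toℕ k ≤ toℕ l →
                Inner (margin i) j → Inner (margin l) j → margin k ≤ toℕ j
      between i k l i≤k k≤l inner-i inner-l = proj₁ (Equivalence.to filled⇔
        (colConvex i k l _ (Equivalence.from filled⇔ inner-i) (Equivalence.from filled⇔ inner-l) i≤k k≤l))
      noValley : ∀ {i k l} → toℕ i ≤ toℕ k → toℕ k ≤ toℕ l → ℓ i ≤ ℓ k ⊎ ℓ l ≤ ℓ k
      noValley {i} {k} {l} i≤k k≤l with ≤-total (ℓ i) (ℓ l)
      ... | inj₁ ℓi≤ℓl = inj₁ (wider-than-edge i
              (between i k l i≤k k≤l (Inner-edge i) (Inner-mono (∸-monoʳ-≤ W ℓi≤ℓl) (Inner-edge i))))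
      ... | inj₂ ℓl≤ℓi = inj₂ (wider-than-edge l
              (between i k l i≤k k≤l (Inner-mono (∸-monoʳ-≤ W ℓl≤ℓi) (Inner-edge l)) (Inner-edge l)))

    rows-EdgeConnected : EdgeConnected rows
    rows-EdgeConnected = column⇒EdgeConnected rows centre (stackRows-RowConvex w W s) centre-filled

    rowLengths-rows : rowLengths W rows ≡ fromList s
    rowLengths-rows = lookup-ext λ i → begin
      lookup (rowLengths W rows) i             ≡⟨ lookup-map i _ rows ⟩
      W ∸ firstTrue (lookup rows i)            ≡⟨ cong (λ r → W ∸ firstTrue r) (lookup-stackRows w W s i) ⟩
      W ∸ firstTrue (centredRow w (margin i))  ≡⟨ cong (W ∸_) (firstTrue-centredRow {a = margin i} (<⇒+< (margin<W i))) ⟩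
      W ∸ margin i                             ≡⟨ m∸[m∸n]≡n (ℓ≤W i) ⟩
      ℓ i                                      ≡⟨ lookup-fromList s i ⟨
      lookup (fromList s) i                    ∎
      where open ≡-Reasoning

-- Stacks and symmetric convex polyominoes

stackGrid : ℕ → Stack → Grid
stackGrid e s = let W = stackWidth s in W + W ∸ e , length s , stackRows (W + W ∸ e) W s

-- Parity 0 (even width) belongs to T(t², t, q²), parity 1 to t⁻¹ T(t², t/q, q²).
tag : ℕ → List ℕ → List ℕ ⊎ List ℕ
tag zero    = inj₁
tag (suc _) = inj₂

readStack : Grid → List ℕ ⊎ List ℕ
readStack (w , h , g) = tag (w % 2) (toList (rowLengths ⌈ w /2⌉ g))

stackGrid-≡ : ∀ {e s w W} → stackWidth s ≡ W → w + e ≡ W + W →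
              stackGrid e s ≡ (w , length s , stackRows w W s)
stackGrid-≡ {e} {s} refl w+e≡W+W =
  cong (λ w → w , length s , stackRows w (stackWidth s) s) (trans (cong (_∸ e) (sym w+e≡W+W)) (m+n∸n≡m _ e))

StackCoeff : ℕ → ℕ → ℕ → Stack → Set
StackCoeff n m e s =
  IsStack s × 2 * stackWidth s + stackHeight s ≡ n + e × 2 * stackArea s ≡ m + stackHeight s * e

coeff-cong : ∀ {A : Set} {x y n n′ m m′ : ℕ} → n ≡ n′ → m ≡ m′ →
             (A × x ≡ n × y ≡ m) ⇔ (A × x ≡ n′ × y ≡ m′)
coeff-cong refl refl = mk⇔ (λ p → p) (λ p → p)

tag-TCoeff⇔ : ∀ {n m e s} → e ≤ 1 → [ TCoeff₁ n m , TCoeff₂ n m ]′ (tag e s) ⇔ StackCoeff n m e s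
tag-TCoeff⇔ {n} {m} {s = s} z≤n       =
  coeff-cong (sym (+-identityʳ n)) (sym (trans (cong (m +_) (*-zeroʳ (length s))) (+-identityʳ m)))
tag-TCoeff⇔ {n} {m} {s = s} (s≤s z≤n) = coeff-cong (+-comm 1 n) (cong (m +_) (sym (*-identityʳ (length s))))

module OfStack {e : ℕ} (e≤1 : e ≤ 1) {s : Stack} (isStack : IsStack s) where

  W w : ℕ
  W = stackWidth s
  w = W + W ∸ e

  bounded : All (λ ℓ → 0 < ℓ × ℓ ≤ W) s
  bounded = All.zip (proj₁ (proj₂ isStack) , All-≤-stackWidth s)

  0<W : 0 < W
  0<W = let (0<ℓ , ℓ≤W) = All-at bounded (proj₁ isStack) in ≤-trans 0<ℓ ℓ≤W

  w+e≡W+W : w + e ≡ W + W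
  w+e≡W+W = m∸n+n≡m (≤-trans e≤1 (≤-trans 0<W (m≤m+n W W)))

  open StackRows e≤1 w+e≡W+W 0<W
  open Bounded bounded

  widest : ∃ λ r → ℓ r ≡ W
  widest with stackWidth-attained {s} (proj₁ isStack)
  ... | r , r<len , at-r≡W = fromℕ< r<len , trans (cong (at s) (toℕ-fromℕ< r<len)) at-r≡W

  convex : IsConvexPolyomino (stackGrid e s)
  convex = ( column-row⇒TightBox {g = rows} centre (proj₁ widest) centre-filled (full (proj₂ widest))
           , rows-EdgeConnected )
         , stackRows-RowConvex w W s
         , NoValley⇒ColConvex (unimodal⇒noValley (proj₂ (proj₂ isStack)))

  halfPerimeter-stackGrid : halfPerimeter (stackGrid e s) + e ≡ 2 * W + length s
  halfPerimeter-stackGrid = begin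
    w + length s + e    ≡⟨ +-assoc w (length s) e ⟩
    w + (length s + e)  ≡⟨ cong (w +_) (+-comm (length s) e) ⟩
    w + (e + length s)  ≡⟨ +-assoc w e (length s) ⟨
    w + e + length s    ≡⟨ cong (_+ length s) (trans w+e≡W+W (cong (W +_) (sym (+-identityʳ W)))) ⟩
    2 * W + length s    ∎
    where open ≡-Reasoning

  area-stackGrid : area (stackGrid e s) + length s * e ≡ 2 * stackArea s
  area-stackGrid = trans (area-stackRows bounded) (cong (sum s +_) (sym (+-identityʳ (sum s))))

  FvCoeff⇔StackCoeff : ∀ {n m} → FvCoeff n m (stackGrid e s) ⇔ StackCoeff n m e s
  FvCoeff⇔StackCoeff = mk⇔
    (λ (_ , _ , hp≡n , area≡m) → isStack
                               , trans (sym halfPerimeter-stackGrid) (cong (_+ e) hp≡n)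
                               , trans (sym area-stackGrid) (cong (_+ length s * e) area≡m))
    (λ (_ , 2W+h≡n+e , 2A≡m+he) → convex
                                , stackRows-symmetric w W s
                                , +-cancelʳ-≡ e _ _ (trans halfPerimeter-stackGrid 2W+h≡n+e)
                                , +-cancelʳ-≡ (length s * e) _ _ (trans area-stackGrid 2A≡m+he))

  readStack-stackGrid : readStack (stackGrid e s) ≡ tag e s
  readStack-stackGrid = cong₂ tag (proj₂ halves) (begin
    toList (rowLengths ⌈ w /2⌉ rows)  ≡⟨ cong (λ V → toList (rowLengths V rows)) (proj₁ halves) ⟩
    toList (rowLengths W rows)        ≡⟨ cong toList rowLengths-rows ⟩
    toList (fromList s)               ≡⟨ toList∘fromList s ⟩
    s                                 ∎)
    where
    open ≡-Reasoning
    halves = halving-unique {W = W} e≤1 w+e≡W+W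

module SymmetricConvex {w h : ℕ} {g : Vec (Vec Bool w) h}
                       (convex : IsConvexPolyomino (w , h , g)) (symmetric : VerticallySymmetric (w , h , g)) where

  W e : ℕ
  W = ⌈ w /2⌉
  e = w % 2

  tight : TightBox g
  tight = proj₁ (proj₁ convex)

  rowConvex : RowConvex g
  rowConvex = proj₁ (proj₂ convex)

  colConvex : ColConvex g
  colConvex = proj₂ (proj₂ convex)

  margin : Fin h → ℕ
  margin i = firstTrue (lookup g i)

  row-centred : ∀ i → lookup g i ≡ centredRow w (margin i)
  row-centred i = symmetric-convex⇒centredRow (lookup g i)
    (trans (sym (lookup-map i reverse g)) (cong (λ v → lookup v i) symmetric)) (rowConvex i)

  filled⇔ : ∀ {i j} → Filled g (i , j) ⇔ Inner (margin i) j
  filled⇔ {i} {j} =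
    subst (λ r → lookup r j ≡ true ⇔ Inner (margin i) j) (sym (row-centred i)) (centredRow-true j)

  0<W : 0 < W
  0<W = 0<⌈n/2⌉ (≤-<-trans z≤n (toℕ<n (proj₂ (proj₁ (proj₁ tight)))))

  open StackRows (%2≤1 w) (halving w) 0<W

  centre-in-row : ∀ {i j} → Filled g (i , j) → Filled g (i , centre)
  centre-in-row {j = j} f = Equivalence.from filled⇔ (Inner-centre (Inner⇒< j (Equivalence.to filled⇔ f)))

  -- The bottom and top rows contain the centre column, hence so does every row in between.
  centre-filled : ∀ i → Filled g (i , centre)
  centre-filled i =
    colConvex _ i _ centre (centre-in-row (proj₁ (proj₂ bottom))) (centre-in-row (proj₁ (proj₂ top)))
              (subst (_≤ toℕ i) (sym (proj₂ (proj₂ bottom))) z≤n)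
              (s≤s⁻¹ (subst (toℕ i <_) (sym (proj₂ (proj₂ top))) (toℕ<n i)))
    where
    bottom = proj₁ tight
    top = proj₁ (proj₂ tight)

  margin<W : ∀ i → margin i < W
  margin<W i = Inner⇒< centre (Equivalence.to filled⇔ (centre-filled i))

  lengths : Vec ℕ h
  lengths = rowLengths W g

  stack : Stack
  stack = toList lengths

  bounded : All (λ ℓ → 0 < ℓ × ℓ ≤ W) stack
  bounded = All-toList lengths λ i → subst (λ ℓ → 0 < ℓ × ℓ ≤ W) (sym (lookup-map i _ g))
                                           (m<n⇒0<n∸m (margin<W i) , m∸n≤m W (margin i))

  stackRows-stack : _≡_ {A = Σ ℕ (Vec (Vec Bool w))} (length stack , stackRows w W stack) (h , g)
  stackRows-stack =
    trans (cong (λ (n , v) → n , Vec.map (λ ℓ → centredRow w (W ∸ ℓ)) v) (Σ-fromList∘toList lengths))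
          (cong (h ,_) (lookup-ext λ i → begin
    lookup (Vec.map (λ ℓ → centredRow w (W ∸ ℓ)) lengths) i
      ≡⟨ lookup-map i _ lengths ⟩
    centredRow w (W ∸ lookup lengths i)
      ≡⟨ cong (λ ℓ → centredRow w (W ∸ ℓ)) (lookup-map i _ g) ⟩
    centredRow w (W ∸ (W ∸ margin i))
      ≡⟨ cong (centredRow w) (m∸[m∸n]≡n (<⇒≤ (margin<W i))) ⟩
    centredRow w (margin i)
      ≡⟨ row-centred i ⟨
    lookup g i
      ∎))
    where open ≡-Reasoning

  isStack : IsStack stack
  isStack = subst (0 <_) (sym (length-toList lengths)) (≤-<-trans z≤n (toℕ<n (proj₁ (proj₁ (proj₁ tight)))))
          , All.map proj₁ bounded
          , noValley⇒unimodal (Bounded.ColConvex⇒NoValley bounded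
              (subst (λ (_ , v) → ColConvex v) (sym stackRows-stack) colConvex))

  stackWidth-stack : stackWidth stack ≡ W
  stackWidth-stack = ≤-antisym (stackWidth-≤ (All.map proj₂ bounded)) (begin
    W                 ≡⟨ cong (W ∸_) margin≡0 ⟨
    W ∸ margin r      ≡⟨ lookup-map r _ g ⟨
    lookup lengths r  ≡⟨ at-toList lengths r ⟨
    at stack (toℕ r)  ≤⟨ All-at (All-≤-stackWidth stack) r<len ⟩
    stackWidth stack  ∎)
    where
    open ≤-Reasoning
    left = proj₁ (proj₂ (proj₂ tight))
    r = proj₁ (proj₁ left)
    margin≡0 : margin r ≡ 0
    margin≡0 = n≤0⇒n≡0 (subst (margin r ≤_) (proj₂ (proj₂ left))
                                (proj₁ (Equivalence.to filled⇔ (proj₁ (proj₂ left)))))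
    r<len = subst (toℕ r <_) (sym (length-toList lengths)) (toℕ<n r)

  stackGrid-stack : stackGrid e stack ≡ (w , h , g)
  stackGrid-stack = trans (stackGrid-≡ stackWidth-stack (halving w)) (cong (w ,_) stackRows-stack)

module Correspondence (n m : ℕ) where

  TCoeff : List ℕ ⊎ List ℕ → Set
  TCoeff = [ TCoeff₁ n m , TCoeff₂ n m ]′

  fromStacks : List ℕ ⊎ List ℕ → Grid
  fromStacks = [ stackGrid 0 , stackGrid 1 ]′

  fromStacks-tag : ∀ {e} s → e ≤ 1 → fromStacks (tag e s) ≡ stackGrid e s
  fromStacks-tag s z≤n       = refl
  fromStacks-tag s (s≤s z≤n) = refl

  fromStacks-FvCoeff : ∀ {x} → TCoeff x → FvCoeff n m (fromStacks x)
  fromStacks-FvCoeff {inj₁ s} p = Equivalence.from (OfStack.FvCoeff⇔StackCoeff z≤n (proj₁ p))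
                                                   (Equivalence.to (tag-TCoeff⇔ z≤n) p)
  fromStacks-FvCoeff {inj₂ s} p = Equivalence.from (OfStack.FvCoeff⇔StackCoeff (s≤s z≤n) (proj₁ p))
                                                   (Equivalence.to (tag-TCoeff⇔ (s≤s z≤n)) p)

  readStack-fromStacks : ∀ {x} → TCoeff x → readStack (fromStacks x) ≡ x
  readStack-fromStacks {inj₁ s} p = OfStack.readStack-stackGrid z≤n (proj₁ p)
  readStack-fromStacks {inj₂ s} p = OfStack.readStack-stackGrid (s≤s z≤n) (proj₁ p)

  readStack-FvCoeff : ∀ {G} → FvCoeff n m G → TCoeff (readStack G)
  readStack-FvCoeff {w , h , g} fv@(convex , symmetric , _) = Equivalence.from (tag-TCoeff⇔ (%2≤1 w))
    (Equivalence.to (OfStack.FvCoeff⇔StackCoeff (%2≤1 w) isStack) (subst (FvCoeff n m) (sym stackGrid-stack) fv))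
    where open SymmetricConvex convex symmetric

  fromStacks-readStack : ∀ {G} → FvCoeff n m G → fromStacks (readStack G) ≡ G
  fromStacks-readStack {w , h , g} (convex , symmetric , _) = trans (fromStacks-tag stack (%2≤1 w)) stackGrid-stack
    where open SymmetricConvex convex symmetric

mainTheorem16 : (n m : ℕ) →
    Σ ℕ λ k₀ → Σ ℕ λ k₁ → Σ ℕ λ k₂ →
      HasCount (FvCoeff n m) k₀ × HasCount (TCoeff₁ n m) k₁
      × HasCount (TCoeff₂ n m) k₂ × k₀ ≡ k₁ + k₂
mainTheorem16 n m =
  let (k₁ , count₁) = hasCount-TCoeff₁ n m
      (k₂ , count₂) = hasCount-TCoeff₂ n m
  in k₁ + k₂ , k₁ , k₂
   , hasCount-inverse fromStacks readStack (λ {x} → fromStacks-FvCoeff {x}) (λ {G} → readStack-FvCoeff {G})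
                      (λ {x} → readStack-fromStacks {x}) (λ {G} → fromStacks-readStack {G})
                      (hasCount-⊎ count₁ count₂)
   , count₁ , count₂ , refl
  where open Correspondence n m
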